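{- Let $f\in x+x^2\mathbb{C}[[x]]$, let $n\ge0$ be an integer, and let $q_n(\alpha)$ be any monic polynomial of degree $n$. Then $$p_n^{\mathfrak{T}^{ -1}f}(\alpha)=\frac{1}{n!}\bigl(\alpha f(D)\bigr)_n\, q_n(\alpha).$$ In particular, $p_n^{\mathfrak{T}^{ -1}f}(\alpha)=\frac{1}{n!}\bigl(\alpha f(D)\bigr)_n\,p_n^f(\alpha)$.
   Context: $x+x^2\mathbb{C}[[x]]$ is the set of formal power series with zero constant term and linear coefficient 1. $\mathfrak{T}f:=f/f'$ is a bijection of this set onto itself, with inverse $\mathfrak{T}^{ -1}$. For $g$ in this set, the polynomials $p_n^g$ are defined by $\sum_{n\ge0}p_n^g(\alpha)x^n/n!=\exp(\alpha g^{inv}(x))$, with $g^{inv}$ the compositional inverse. $D=d/d\alpha$ acts on $\mathbb{C}[\alpha]$, $f(D)=\sum f_kD^k$ for $f=\sum f_kx^k$, and $\alpha f(D)$ is the operator "apply $f(D)$, then multiply by $\alpha$". For an operator $X$, $(X)_n=X(X-1)\cdots(X-n+1)$ (with $(X)_0=1$). -}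

module Defs where

open import Level using (Level; _⊔_)
open import Data.Nat using (ℕ; zero; suc)
open import Data.List using (List; []; _∷_; length)
open import Data.Product using (_×_)
open import Algebra.Bundles using (CommutativeRing)

-- Everything is developed over a commutative ring R in which every positive
-- integer is invertible ( inv k  is the inverse of  k+1 ), i.e. a Q-algebra.
-- For the paper, R = ℂ.
module PS {c ℓ : Level} (R : CommutativeRing c ℓ)
          (inv : ℕ → CommutativeRing.Carrier R) where

  open CommutativeRing R

  nat : ℕ → Carrier
  nat zero    = 0#
  nat (suc n) = 1# + nat n

  InvertsPositiveIntegers : Set ℓ
  InvertsPositiveIntegers = ∀ k → nat (suc k) * inv k ≈ 1#

  fact : ℕ → Carrier
  fact zero    = 1#
  fact (suc n) = nat (suc n) * fact n

  invFact : ℕ → Carrier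
  invFact zero    = 1#
  invFact (suc n) = inv n * invFact n

  sumTo : ℕ → (ℕ → Carrier) → Carrier
  sumTo zero    a = a 0
  sumTo (suc n) a = sumTo n a + a (suc n)

  Series : Set c
  Series = ℕ → Carrier

  _≈S_ : Series → Series → Set ℓ
  a ≈S b = ∀ n → a n ≈ b n

  InX+X² : Series → Set ℓ
  InX+X² a = (a 0 ≈ 0#) × (a 1 ≈ 1#)

  oneS : Series
  oneS zero    = 1#
  oneS (suc _) = 0#

  xS : Series
  xS 1 = 1#
  xS _ = 0#

  _-S_ : Series → Series → Series
  (a -S b) n = a n - b n

  mulS : Series → Series → Series
  mulS a b n = sumTo n (λ i → a i * b (n Data.Nat.∸ i))

  powS : Series → ℕ → Series
  powS a zero    = oneS
  powS a (suc k) = mulS a (powS a k)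

  -- composition g ∘ h (meaningful when h 0 = 0):  [xⁿ](g∘h) = Σ_{k≤n} g_k [xⁿ] h^k
  compS : Series → Series → Series
  compS g h n = sumTo n (λ k → g k * powS h k n)

  derivS : Series → Series
  derivS a n = nat (suc n) * a (suc n)

  -- multiplicative inverse of a series with constant term 1:
  -- 1/a = 1/(1 - (1 - a)) = Σ_k (1 - a)^k
  recipS : Series → Series
  recipS a = compS (λ _ → 1#) (oneS -S a)

  T : Series → Series
  T f = mulS f (recipS (derivS f))

  -- The polynomials p_n^g.  If h = g^{inv}, then
  --   exp(α h(x)) = Σ_k α^k h(x)^k / k!,
  -- so the coefficient of α^k xⁿ in exp(α h(x)) is  [xⁿ] h^k / k!.
  expCoeff : Series → ℕ → ℕ → Carrier
  expCoeff h n k = invFact k * powS h k n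

  -- polynomials in α as coefficient lists (constant term first)
  Poly : Set c
  Poly = List Carrier

  coeff : Poly → ℕ → Carrier
  coeff []      _       = 0#
  coeff (a ∷ p) zero    = a
  coeff (a ∷ p) (suc i) = coeff p i

  _≈P_ : Poly → Poly → Set ℓ
  p ≈P q = ∀ i → coeff p i ≈ coeff q i

  tab : ℕ → (ℕ → Carrier) → Poly
  tab zero    e = []
  tab (suc n) e = e 0 ∷ tab n (λ k → e (suc k))

  -- p_n^g(α) = n! [xⁿ] exp(α h(x)) with h = g^{inv}; of degree ≤ n
  pPoly : (h : Series) → ℕ → Poly
  pPoly h n = tab (suc n) (λ k → fact n * expCoeff h n k)

  _+P_ : Poly → Poly → Poly
  []      +P q       = q
  (a ∷ p) +P []      = a ∷ p
  (a ∷ p) +P (b ∷ q) = (a + b) ∷ (p +P q)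

  scaleP : Carrier → Poly → Poly
  scaleP c []      = []
  scaleP c (a ∷ p) = (c * a) ∷ scaleP c p

  Dhelp : ℕ → Poly → Poly
  Dhelp i []      = []
  Dhelp i (b ∷ p) = (nat i * b) ∷ Dhelp (suc i) p

  D : Poly → Poly
  D []      = []
  D (a ∷ p) = Dhelp 1 p

  Dpow : ℕ → Poly → Poly
  Dpow zero    p = p
  Dpow (suc k) p = D (Dpow k p)

  -- f(D) p = Σ_k f_k D^k p  (D^k p = 0 for k > deg p, so k ≤ length p suffices)
  fDsum : Series → ℕ → Poly → Poly
  fDsum f zero    p = scaleP (f 0) p
  fDsum f (suc k) p = fDsum f k p +P scaleP (f (suc k)) (Dpow (suc k) p)

  fD : Series → Poly → Poly
  fD f p = fDsum f (length p) p

  αfD : Series → Poly → Poly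
  αfD f p = 0# ∷ fD f p

  -- (X)_n with X = α f(D):  (X)_0 = 1,  (X)_{m+1} = (X)_m ∘ (X - m)
  fallingαfD : Series → ℕ → Poly → Poly
  fallingαfD f zero    p = p
  fallingαfD f (suc m) p = fallingαfD f m (αfD f p +P scaleP (- nat m) p)

  MonicOfDegree : ℕ → Poly → Set ℓ
  MonicOfDegree n q = (length q Relation.Binary.PropositionalEquality.≡ suc n) × (coeff q n ≈ 1#)
    where import Relation.Binary.PropositionalEquality

module Submission where

-- Write X = α f(D) and g = 𝔗⁻¹f, so f g' = g.  Composing with
-- h = g^{inv} and using the chain rule (g'∘h) h' = 1 gives
--   f∘h = x h'.                                                   (★)
-- Since Σ_k f_k h^{k+i} = (f∘h) h^i = x h^i h' = x (h^{i+1})'/(i+1), the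
-- coefficient [xⁿ] of (★)·h^i shows that p_n^h is an eigenvector of X
-- with eigenvalue n.  On the other hand X has no degree-raising part and,
-- because f_0 = 0 and f_1 = 1, acts on α^m as m α^m plus lower terms;
-- so X - m lowers the degree of anything of degree ≤ m, and
-- (X)_n = (X - n + 1)⋯(X - 1)X annihilates all polynomials of degree < n.
-- Writing q = p_n^h + r with deg r < n therefore gives
--   (X)_n q = n(n-1)⋯1 · p_n^h = n! p_n^h.

open import Level using (Level)
open import Data.Nat using (ℕ; zero; suc; _≤_; _<_; z≤n; s≤s; _∸_; _<?_)
  renaming (_+_ to _+ℕ_; _≟_ to _≟ℕ_)
import Data.Nat.Properties as ℕₚ
open import Data.Product using (_×_; _,_)
open import Data.List using ([]; _∷_; length)
open import Data.Empty using (⊥-elim)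
open import Relation.Nullary using (yes; no; ¬_)
open import Relation.Binary.PropositionalEquality as Eq using (_≡_)
open import Algebra.Bundles using (CommutativeRing)
open import Defs

module Development {c ℓ : Level} (R : CommutativeRing c ℓ)
                   (inv : ℕ → CommutativeRing.Carrier R) where

  open CommutativeRing R hiding (zero)
  open PS R inv
  open import Relation.Binary.Reasoning.Setoid setoid
  open import Algebra.Solver.Ring.NaturalCoefficients.Default commutativeSemiring
  open import Algebra.Properties.Ring ring using (-‿distribʳ-*; -‿distribˡ-*; -1*x≈-x)
  open import Algebra.Properties.AbelianGroup +-abelianGroup using (⁻¹-∙-comm; ⁻¹-anti-homo‿-; xyx⁻¹≈y)
  open import Algebra.Properties.Group +-group using (ε⁻¹≈ε)

  -- Finite sums  sumTo n a = Σ_{i ≤ n} a i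

  Σ-cong : ∀ n {a b : ℕ → Carrier} → (∀ i → i ≤ n → a i ≈ b i) → sumTo n a ≈ sumTo n b
  Σ-cong zero    eq = eq 0 z≤n
  Σ-cong (suc n) eq = +-cong (Σ-cong n (λ i i≤n → eq i (ℕₚ.m≤n⇒m≤1+n i≤n))) (eq (suc n) ℕₚ.≤-refl)

  Σ-cong′ : ∀ n {a b : ℕ → Carrier} → (∀ i → a i ≈ b i) → sumTo n a ≈ sumTo n b
  Σ-cong′ n eq = Σ-cong n (λ i _ → eq i)

  Σ-+ : ∀ n (a b : ℕ → Carrier) → sumTo n (λ i → a i + b i) ≈ sumTo n a + sumTo n b
  Σ-+ zero    a b = refl
  Σ-+ (suc n) a b = begin
      sumTo n (λ i → a i + b i) + (a (suc n) + b (suc n))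
    ≈⟨ +-congʳ (Σ-+ n a b) ⟩
      (sumTo n a + sumTo n b) + (a (suc n) + b (suc n))
    ≈⟨ solve 4 (λ w x y z → (w :+ x) :+ (y :+ z) := (w :+ y) :+ (x :+ z)) refl _ _ _ _ ⟩
      (sumTo n a + a (suc n)) + (sumTo n b + b (suc n)) ∎

  Σ-*ˡ : ∀ n x (a : ℕ → Carrier) → x * sumTo n a ≈ sumTo n (λ i → x * a i)
  Σ-*ˡ zero    x a = refl
  Σ-*ˡ (suc n) x a = trans (distribˡ x _ _) (+-congʳ (Σ-*ˡ n x a))

  Σ-*ʳ : ∀ n x (a : ℕ → Carrier) → sumTo n a * x ≈ sumTo n (λ i → a i * x)
  Σ-*ʳ zero    x a = refl
  Σ-*ʳ (suc n) x a = trans (distribʳ x _ _) (+-congʳ (Σ-*ʳ n x a))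

  Σ-neg : ∀ n (a : ℕ → Carrier) → sumTo n (λ i → - a i) ≈ - sumTo n a
  Σ-neg zero    a = refl
  Σ-neg (suc n) a = trans (+-congʳ (Σ-neg n a)) (⁻¹-∙-comm _ _)

  Σ-zero : ∀ n {a : ℕ → Carrier} → (∀ i → i ≤ n → a i ≈ 0#) → sumTo n a ≈ 0#
  Σ-zero zero    z = z 0 z≤n
  Σ-zero (suc n) z = trans (+-cong (Σ-zero n (λ i i≤n → z i (ℕₚ.m≤n⇒m≤1+n i≤n))) (z (suc n) ℕₚ.≤-refl))
                           (+-identityˡ 0#)

  Σ-single : ∀ n j (a : ℕ → Carrier) → j ≤ n → (∀ i → i ≤ n → ¬ i ≡ j → a i ≈ 0#) → sumTo n a ≈ a j
  Σ-single zero    .zero a z≤n z = refl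
  Σ-single (suc n) j     a j≤  z with j ≟ℕ suc n
  ... | yes Eq.refl = trans (+-congʳ (Σ-zero n (λ i i≤n → z i (ℕₚ.m≤n⇒m≤1+n i≤n) (ℕₚ.<⇒≢ (s≤s i≤n)))))
                            (+-identityˡ _)
  ... | no  j≢      = trans (+-cong (Σ-single n j a (ℕₚ.≤-pred (ℕₚ.≤∧≢⇒< j≤ j≢)) (λ i i≤n → z i (ℕₚ.m≤n⇒m≤1+n i≤n)))
                                    (z (suc n) ℕₚ.≤-refl (λ e → j≢ (Eq.sym e))))
                            (+-identityʳ _)

  Σ-peel : ∀ n (a : ℕ → Carrier) → sumTo (suc n) a ≈ a 0 + sumTo n (λ i → a (suc i))
  Σ-peel zero    a = refl
  Σ-peel (suc n) a = trans (+-congʳ (Σ-peel n a)) (+-assoc _ _ _)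

  Σ-reverse : ∀ n (a : ℕ → Carrier) → sumTo n a ≈ sumTo n (λ i → a (n ∸ i))
  Σ-reverse zero    a = refl
  Σ-reverse (suc n) a = begin
      sumTo n a + a (suc n)
    ≈⟨ +-comm _ _ ⟩
      a (suc n) + sumTo n a
    ≈⟨ +-congˡ (Σ-reverse n a) ⟩
      a (suc n) + sumTo n (λ i → a (n ∸ i))
    ≈⟨ Σ-peel n (λ i → a (suc n ∸ i)) ⟨
      sumTo (suc n) (λ i → a (suc n ∸ i)) ∎

  Σ-extend : ∀ k n (a : ℕ → Carrier) → k ≤ n → (∀ i → k < i → i ≤ n → a i ≈ 0#) → sumTo n a ≈ sumTo k a
  Σ-extend k n a k≤n z with ℕₚ.m≤n⇒∃[o]m+o≡n k≤n
  ... | d , Eq.refl rewrite ℕₚ.+-comm k d = extendBy d z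
    where
    extendBy : ∀ d → (∀ i → k < i → i ≤ d +ℕ k → a i ≈ 0#) → sumTo (d +ℕ k) a ≈ sumTo k a
    extendBy zero    z = refl
    extendBy (suc d) z = trans (+-cong (extendBy d (λ i k<i i≤ → z i k<i (ℕₚ.m≤n⇒m≤1+n i≤)))
                                       (z _ (s≤s (ℕₚ.m≤n+m k d)) ℕₚ.≤-refl))
                               (+-identityʳ _)

  Σ-swap : ∀ n m (a : ℕ → ℕ → Carrier) →
           sumTo n (λ i → sumTo m (λ j → a i j)) ≈ sumTo m (λ j → sumTo n (λ i → a i j))
  Σ-swap zero    m a = refl
  Σ-swap (suc n) m a = trans (+-congʳ (Σ-swap n m a)) (sym (Σ-+ m _ _))

  Σ-triangle : ∀ n (F : ℕ → ℕ → Carrier) →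
               sumTo n (λ k → sumTo k (λ m → F m (k ∸ m))) ≈ sumTo n (λ m → sumTo (n ∸ m) (F m))
  Σ-triangle zero    F = refl
  Σ-triangle (suc n) F = begin
      sumTo n (λ k → sumTo k (λ m → F m (k ∸ m))) + sumTo (suc n) (λ m → F m (suc n ∸ m))
    ≈⟨ +-cong (Σ-triangle n F)
              (+-cong (Σ-cong n (λ m m≤n → reflexive (Eq.cong (F m) (ℕₚ.+-∸-assoc 1 m≤n))))
                      (reflexive (Eq.cong (F (suc n)) (ℕₚ.n∸n≡0 n)))) ⟩
      sumTo n (λ m → sumTo (n ∸ m) (F m)) + (sumTo n (λ m → F m (suc (n ∸ m))) + F (suc n) 0)
    ≈⟨ +-assoc _ _ _ ⟨
      (sumTo n (λ m → sumTo (n ∸ m) (F m)) + sumTo n (λ m → F m (suc (n ∸ m)))) + F (suc n) 0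
    ≈⟨ +-congʳ (Σ-+ n _ _) ⟨
      sumTo n (λ m → sumTo (suc (n ∸ m)) (F m)) + F (suc n) 0
    ≈⟨ +-cong (Σ-cong n (λ m m≤n → reflexive (Eq.cong (λ t → sumTo t (F m)) (Eq.sym (ℕₚ.+-∸-assoc 1 m≤n)))))
              (reflexive (Eq.cong (λ t → sumTo t (F (suc n))) (Eq.sym (ℕₚ.n∸n≡0 n)))) ⟩
      sumTo (suc n) (λ m → sumTo (suc n ∸ m) (F m)) ∎

  -- The ring of formal power series

  _+S_ : Series → Series → Series
  (a +S b) n = a n + b n

  scaleS : Carrier → Series → Series
  scaleS x a n = x * a n

  ≈S-sym : ∀ {a b} → a ≈S b → b ≈S a
  ≈S-sym a≈b n = sym (a≈b n)

  ≈S-trans : ∀ {a b d} → a ≈S b → b ≈S d → a ≈S d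
  ≈S-trans a≈b b≈d n = trans (a≈b n) (b≈d n)

  HasOrder : ℕ → Series → Set ℓ
  HasOrder m a = ∀ n → n < m → a n ≈ 0#

  mulS-cong : ∀ {a a′ b b′} → a ≈S a′ → b ≈S b′ → mulS a b ≈S mulS a′ b′
  mulS-cong a≈ b≈ n = Σ-cong′ n (λ i → *-cong (a≈ i) (b≈ (n ∸ i)))

  mulS-congˡ : ∀ {a a′} b → a ≈S a′ → mulS a b ≈S mulS a′ b
  mulS-congˡ b a≈ = mulS-cong {b = b} a≈ (λ _ → refl)

  mulS-congʳ : ∀ a {b b′} → b ≈S b′ → mulS a b ≈S mulS a b′
  mulS-congʳ a b≈ = mulS-cong {a = a} (λ _ → refl) b≈

  mulS-comm : ∀ a b → mulS a b ≈S mulS b a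
  mulS-comm a b n = trans (Σ-reverse n _)
    (Σ-cong n (λ i i≤n → trans (*-comm _ _) (*-congʳ (reflexive (Eq.cong b (ℕₚ.m∸[m∸n]≡n i≤n))))))

  mulS-assoc : ∀ a b d → mulS (mulS a b) d ≈S mulS a (mulS b d)
  mulS-assoc a b d n = begin
      sumTo n (λ k → sumTo k (λ m → a m * b (k ∸ m)) * d (n ∸ k))
    ≈⟨ Σ-cong′ n (λ k → Σ-*ʳ k _ _) ⟩
      sumTo n (λ k → sumTo k (λ m → a m * b (k ∸ m) * d (n ∸ k)))
    ≈⟨ Σ-cong′ n (λ k → Σ-cong k (λ m m≤k → trans (*-assoc _ _ _)
         (*-congˡ (*-congˡ (reflexive (Eq.cong (λ t → d (n ∸ t)) (Eq.sym (ℕₚ.m+[n∸m]≡n m≤k)))))))) ⟩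
      sumTo n (λ k → sumTo k (λ m → F m (k ∸ m)))
    ≈⟨ Σ-triangle n F ⟩
      sumTo n (λ m → sumTo (n ∸ m) (F m))
    ≈⟨ Σ-cong′ n (λ m → trans (Σ-cong′ (n ∸ m) (λ j → *-congˡ (*-congˡ (reflexive (Eq.cong d (Eq.sym (ℕₚ.∸-+-assoc n m j)))))))
                              (sym (Σ-*ˡ (n ∸ m) _ _))) ⟩
      sumTo n (λ m → a m * mulS b d (n ∸ m)) ∎
    where
    F : ℕ → ℕ → Carrier
    F m j = a m * (b j * d (n ∸ (m +ℕ j)))

  mulS-scaleˡ : ∀ x a b → mulS (scaleS x a) b ≈S scaleS x (mulS a b)
  mulS-scaleˡ x a b n = trans (Σ-cong′ n (λ i → *-assoc _ _ _)) (sym (Σ-*ˡ n _ _))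

  mulS-scaleʳ : ∀ x a b → mulS a (scaleS x b) ≈S scaleS x (mulS a b)
  mulS-scaleʳ x a b n = trans (Σ-cong′ n (λ i → solve 3 (λ u v w → u :* (v :* w) := v :* (u :* w)) refl _ _ _))
                              (sym (Σ-*ˡ n _ _))

  mulS-−ʳ : ∀ a b d → mulS a (b -S d) ≈S (mulS a b -S mulS a d)
  mulS-−ʳ a b d n = trans (Σ-cong′ n (λ i → trans (distribˡ _ _ _) (+-congˡ (sym (-‿distribʳ-* _ _)))))
                          (trans (Σ-+ n _ _) (+-congˡ (Σ-neg n _)))

  mulS-oneˡ : ∀ a → mulS oneS a ≈S a
  mulS-oneˡ a zero    = *-identityˡ _
  mulS-oneˡ a (suc n) = trans (Σ-peel n _) (trans (+-cong (*-identityˡ _) (Σ-zero n (λ i _ → zeroˡ _))) (+-identityʳ _))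

  mulS-oneʳ : ∀ a → mulS a oneS ≈S a
  mulS-oneʳ a = ≈S-trans (mulS-comm a oneS) (mulS-oneˡ a)

  mulS-x-zero : ∀ a → mulS xS a 0 ≈ 0#
  mulS-x-zero a = zeroˡ _

  mulS-x-suc : ∀ a n → mulS xS a (suc n) ≈ a n
  mulS-x-suc a n = trans (Σ-single (suc n) 1 _ (s≤s z≤n) offDiagonal) (*-identityˡ _)
    where
    offDiagonal : ∀ i → i ≤ suc n → ¬ i ≡ 1 → xS i * a (suc n ∸ i) ≈ 0#
    offDiagonal zero          _ _   = zeroˡ _
    offDiagonal (suc zero)    _ i≢1 = ⊥-elim (i≢1 Eq.refl)
    offDiagonal (suc (suc i)) _ _   = zeroˡ _

  mulS-order : ∀ p q a b → HasOrder p a → HasOrder q b → HasOrder (p +ℕ q) (mulS a b)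
  mulS-order p q a b oa ob n n<p+q = Σ-zero n vanish
    where
    vanish : ∀ i → i ≤ n → a i * b (n ∸ i) ≈ 0#
    vanish i i≤n with i <? p
    ... | yes i<p = trans (*-congʳ (oa i i<p)) (zeroˡ _)
    ... | no  i≮p = trans (*-congˡ (ob (n ∸ i) n-i<q)) (zeroʳ _)
      where
      n-i<q : n ∸ i < q
      n-i<q = ℕₚ.+-cancelˡ-< i (n ∸ i) q
                (Eq.subst (_< i +ℕ q) (Eq.sym (ℕₚ.m+[n∸m]≡n i≤n))
                  (ℕₚ.<-≤-trans n<p+q (ℕₚ.+-monoˡ-≤ q (ℕₚ.≮⇒≥ i≮p))))

  mulS-leading : ∀ p q a b → HasOrder p a → HasOrder q b → mulS a b (p +ℕ q) ≈ a p * b q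
  mulS-leading p q a b oa ob =
    trans (Σ-single (p +ℕ q) p _ (ℕₚ.m≤m+n p q) offDiagonal) (*-congˡ (reflexive (Eq.cong b (ℕₚ.m+n∸m≡n p q))))
    where
    offDiagonal : ∀ i → i ≤ p +ℕ q → ¬ i ≡ p → a i * b (p +ℕ q ∸ i) ≈ 0#
    offDiagonal i i≤ i≢p with i <? p
    ... | yes i<p = trans (*-congʳ (oa i i<p)) (zeroˡ _)
    ... | no  i≮p = trans (*-congˡ (ob _ rest<q)) (zeroʳ _)
      where
      p<i : p < i
      p<i = ℕₚ.≤∧≢⇒< (ℕₚ.≮⇒≥ i≮p) (λ e → i≢p (Eq.sym e))
      rest<q : p +ℕ q ∸ i < q
      rest<q = ℕₚ.+-cancelˡ-< i _ q (Eq.subst (_< i +ℕ q) (Eq.sym (ℕₚ.m+[n∸m]≡n i≤)) (ℕₚ.+-monoˡ-< q p<i))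

  module Powers (h : Series) (h0 : h 0 ≈ 0#) where

    order-one : HasOrder 1 h
    order-one zero _ = h0
    order-one (suc n) (s≤s ())

    powS-order : ∀ k → HasOrder k (powS h k)
    powS-order zero    n ()
    powS-order (suc k) = mulS-order 1 k h (powS h k) order-one (powS-order k)

    powS-leading : h 1 ≈ 1# → ∀ k → powS h k k ≈ 1#
    powS-leading h1 zero    = refl
    powS-leading h1 (suc k) = trans (mulS-leading 1 k h (powS h k) order-one (powS-order k))
                                    (trans (*-cong h1 (powS-leading h1 k)) (*-identityˡ _))

    powS-+ : ∀ i j → powS h (i +ℕ j) ≈S mulS (powS h i) (powS h j)
    powS-+ zero    j = ≈S-sym (mulS-oneˡ (powS h j))
    powS-+ (suc i) j = ≈S-trans (mulS-congʳ h (powS-+ i j)) (≈S-sym (mulS-assoc h (powS h i) (powS h j)))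

  -- Infinite sums of families of increasing order, and composition

  -- Σ_m s_m for a family with s_m ∈ x^m R[[x]]: only m ≤ n contributes to [xⁿ]
  Σ∞ : (ℕ → Series) → Series
  Σ∞ s n = sumTo n (λ m → s m n)

  Σ∞-cong : ∀ {s t : ℕ → Series} → (∀ m → s m ≈S t m) → Σ∞ s ≈S Σ∞ t
  Σ∞-cong s≈t n = Σ-cong′ n (λ m → s≈t m n)

  mulS-Σ∞ : ∀ (s : ℕ → Series) b → (∀ m → HasOrder m (s m)) → mulS (Σ∞ s) b ≈S Σ∞ (λ m → mulS (s m) b)
  mulS-Σ∞ s b os n = begin
      sumTo n (λ i → sumTo i (λ m → s m i) * b (n ∸ i))
    ≈⟨ Σ-cong′ n (λ i → Σ-*ʳ i _ _) ⟩
      sumTo n (λ i → sumTo i (λ m → s m i * b (n ∸ i)))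
    ≈⟨ Σ-cong n (λ i i≤n → sym (Σ-extend i n _ i≤n (λ m i<m _ → trans (*-congʳ (os m i i<m)) (zeroˡ _)))) ⟩
      sumTo n (λ i → sumTo n (λ m → s m i * b (n ∸ i)))
    ≈⟨ Σ-swap n n _ ⟩
      Σ∞ (λ m → mulS (s m) b) n ∎

  -- composition with h is a sum of this kind: a ∘ h = Σ_m a_m h^m
  module Composition (h : Series) (h0 : h 0 ≈ 0#) where
    open Powers h h0

    termOrder : ∀ (a : Series) m → HasOrder m (scaleS (a m) (powS h m))
    termOrder a m n n<m = trans (*-congˡ (powS-order m n n<m)) (zeroʳ _)

    compS-congˡ : ∀ {a b} → a ≈S b → compS a h ≈S compS b h
    compS-congˡ a≈b n = Σ-cong′ n (λ k → *-congʳ (a≈b k))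

    compS-mulS : ∀ a b → mulS (compS a h) b ≈S Σ∞ (λ m → scaleS (a m) (mulS (powS h m) b))
    compS-mulS a b = ≈S-trans (mulS-Σ∞ (λ m → scaleS (a m) (powS h m)) b (termOrder a))
                              (Σ∞-cong (λ m → mulS-scaleˡ (a m) (powS h m) b))

    compS-hom : ∀ a b → compS (mulS a b) h ≈S mulS (compS a h) (compS b h)
    compS-hom a b n = sym (begin
        mulS (compS a h) (compS b h) n
      ≈⟨ compS-mulS a (compS b h) n ⟩
        sumTo n (λ m → a m * mulS (powS h m) (compS b h) n)
      ≈⟨ Σ-cong′ n (λ m → *-congˡ (trans (mulS-comm (powS h m) (compS b h) n)
                                  (trans (compS-mulS b (powS h m) n)
                                         (Σ-cong′ n (λ j → *-congˡ (sym (powS-+ j m n))))))) ⟩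
        sumTo n (λ m → a m * sumTo n (λ j → b j * powS h (j +ℕ m) n))
      ≈⟨ Σ-cong′ n (λ m → *-congˡ (Σ-extend (n ∸ m) n _ (ℕₚ.m∸n≤m n m)
           (λ j n-m<j _ → trans (*-congˡ (powS-order (j +ℕ m) n (n<j+m n-m<j))) (zeroʳ _)))) ⟩
        sumTo n (λ m → a m * sumTo (n ∸ m) (λ j → b j * powS h (j +ℕ m) n))
      ≈⟨ Σ-cong′ n (λ m → Σ-*ˡ (n ∸ m) _ _) ⟩
        sumTo n (λ m → sumTo (n ∸ m) (F m))
      ≈⟨ Σ-triangle n F ⟨
        sumTo n (λ k → sumTo k (λ m → F m (k ∸ m)))
      ≈⟨ Σ-cong′ n (λ k → Σ-cong k (λ m m≤k →
           trans (*-congˡ (*-congˡ (reflexive (Eq.cong (λ t → powS h t n) (ℕₚ.m∸n+n≡m m≤k))))) (sym (*-assoc _ _ _)))) ⟩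
        sumTo n (λ k → sumTo k (λ m → a m * b (k ∸ m) * powS h k n))
      ≈⟨ Σ-cong′ n (λ k → Σ-*ʳ k _ _) ⟨
        compS (mulS a b) h n ∎)
      where
      F : ℕ → ℕ → Carrier
      F m j = a m * (b j * powS h (j +ℕ m) n)

      n<j+m : ∀ {m j} → n ∸ m < j → n < j +ℕ m
      n<j+m {m} {j} n-m<j = Eq.subst (n <_) (ℕₚ.+-comm m j) (ℕₚ.≤-<-trans (ℕₚ.m≤n+m∸n n m) (ℕₚ.+-monoʳ-< m n-m<j))

  -- Formal derivative

  nat-+ : ∀ m n → nat (m +ℕ n) ≈ nat m + nat n
  nat-+ zero    n = sym (+-identityˡ _)
  nat-+ (suc m) n = trans (+-congˡ (nat-+ m n)) (sym (+-assoc _ _ _))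

  nat-one : nat 1 ≈ 1#
  nat-one = +-identityʳ 1#

  derivS-cong : ∀ {a b} → a ≈S b → derivS a ≈S derivS b
  derivS-cong a≈b n = *-congˡ (a≈b (suc n))

  derivS-one : ∀ n → derivS oneS n ≈ 0#
  derivS-one n = zeroʳ _

  derivS-x : derivS xS ≈S oneS
  derivS-x zero    = trans (*-identityʳ _) nat-one
  derivS-x (suc n) = zeroʳ _

  derivS-mulS : ∀ a b → derivS (mulS a b) ≈S (mulS (derivS a) b +S mulS a (derivS b))
  derivS-mulS a b n = begin
      nat (suc n) * sumTo (suc n) (λ i → a i * b (suc n ∸ i))
    ≈⟨ Σ-*ˡ (suc n) _ _ ⟩
      sumTo (suc n) (λ i → nat (suc n) * (a i * b (suc n ∸ i)))
    ≈⟨ Σ-cong (suc n) (λ i i≤ → trans (*-congʳ (trans (reflexive (Eq.cong nat (Eq.sym (ℕₚ.m+[n∸m]≡n i≤))))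
                                                          (nat-+ i (suc n ∸ i))))
                                       (distribʳ _ _ _)) ⟩
      sumTo (suc n) (λ i → nat i * (a i * b (suc n ∸ i)) + nat (suc n ∸ i) * (a i * b (suc n ∸ i)))
    ≈⟨ Σ-+ (suc n) _ _ ⟩
      sumTo (suc n) (λ i → nat i * (a i * b (suc n ∸ i))) + sumTo (suc n) (λ i → nat (suc n ∸ i) * (a i * b (suc n ∸ i)))
    ≈⟨ +-cong derivativeOfFirst derivativeOfSecond ⟩
      (mulS (derivS a) b +S mulS a (derivS b)) n ∎
    where
    derivativeOfFirst : sumTo (suc n) (λ i → nat i * (a i * b (suc n ∸ i))) ≈ mulS (derivS a) b n
    derivativeOfFirst = trans (Σ-peel n _)
      (trans (+-congʳ (zeroˡ _)) (trans (+-identityˡ _) (Σ-cong′ n (λ i → sym (*-assoc _ _ _)))))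

    derivativeOfSecond : sumTo (suc n) (λ i → nat (suc n ∸ i) * (a i * b (suc n ∸ i))) ≈ mulS a (derivS b) n
    derivativeOfSecond = trans (+-cong
        (Σ-cong n (λ i i≤n → trans (reflexive (Eq.cong (λ t → nat t * (a i * b t)) (ℕₚ.+-∸-assoc 1 i≤n)))
                                   (solve 3 (λ x y z → x :* (y :* z) := y :* (x :* z)) refl _ _ _)))
        (trans (*-congʳ (reflexive (Eq.cong nat (ℕₚ.n∸n≡0 n)))) (zeroˡ _)))
      (+-identityʳ _)

  module Derivation (h : Series) (h0 : h 0 ≈ 0#) where
    open Powers h h0
    open Composition h h0

    derivS-powS : ∀ k → derivS (powS h (suc k)) ≈S scaleS (nat (suc k)) (mulS (powS h k) (derivS h))
    derivS-powS zero n = begin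
        nat (suc n) * mulS h oneS (suc n)
      ≈⟨ *-congˡ (mulS-oneʳ h (suc n)) ⟩
        derivS h n
      ≈⟨ mulS-oneˡ (derivS h) n ⟨
        mulS oneS (derivS h) n
      ≈⟨ trans (*-congʳ nat-one) (*-identityˡ _) ⟨
        nat 1 * mulS oneS (derivS h) n ∎
    derivS-powS (suc k) n = begin
        derivS (mulS h (powS h (suc k))) n
      ≈⟨ derivS-mulS h (powS h (suc k)) n ⟩
        mulS (derivS h) (powS h (suc k)) n + mulS h (derivS (powS h (suc k))) n
      ≈⟨ +-cong (mulS-comm _ _ n)
                (trans (mulS-congʳ h (derivS-powS k) n)
                       (trans (mulS-scaleʳ (nat (suc k)) h (mulS (powS h k) (derivS h)) n)
                              (*-congˡ (sym (mulS-assoc h (powS h k) (derivS h) n))))) ⟩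
        Y + nat (suc k) * Y
      ≈⟨ solve 2 (λ y m → y :+ m :* y := (con 1 :+ m) :* y) refl Y (nat (suc k)) ⟩
        nat (suc (suc k)) * Y ∎
      where
      Y : Carrier
      Y = mulS (powS h (suc k)) (derivS h) n

    chain-rule : ∀ a → derivS (compS a h) ≈S mulS (compS (derivS a) h) (derivS h)
    chain-rule a n = begin
        nat (suc n) * sumTo (suc n) (λ k → a k * powS h k (suc n))
      ≈⟨ Σ-*ˡ (suc n) _ _ ⟩
        sumTo (suc n) (λ k → nat (suc n) * (a k * powS h k (suc n)))
      ≈⟨ Σ-cong′ (suc n) (λ k → solve 3 (λ x y z → x :* (y :* z) := y :* (x :* z)) refl _ _ _) ⟩
        sumTo (suc n) (λ k → a k * derivS (powS h k) n)
      ≈⟨ Σ-peel n _ ⟩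
        a 0 * derivS oneS n + sumTo n (λ k → a (suc k) * derivS (powS h (suc k)) n)
      ≈⟨ +-cong (trans (*-congˡ (derivS-one n)) (zeroʳ _)) (Σ-cong′ n (λ k → *-congˡ (derivS-powS k n))) ⟩
        0# + sumTo n (λ k → a (suc k) * (nat (suc k) * mulS (powS h k) (derivS h) n))
      ≈⟨ +-identityˡ _ ⟩
        sumTo n (λ k → a (suc k) * (nat (suc k) * mulS (powS h k) (derivS h) n))
      ≈⟨ Σ-cong′ n (λ k → solve 3 (λ x y z → x :* (y :* z) := (y :* x) :* z) refl _ _ _) ⟩
        sumTo n (λ k → derivS a k * mulS (powS h k) (derivS h) n)
      ≈⟨ compS-mulS (derivS a) (derivS h) n ⟨
        mulS (compS (derivS a) h) (derivS h) n ∎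

  -- Reciprocal of a series with constant term 1

  -- an additive-group identity used to rewrite a as 1 - (1 - a)
  x-[x-y]≈y : ∀ x y → x - (x - y) ≈ y
  x-[x-y]≈y x y = begin
      x - (x - y)      ≈⟨ +-congˡ (⁻¹-anti-homo‿- x y) ⟩
      x + (y - x)      ≈⟨ +-assoc x y (- x) ⟨
      x + y - x        ≈⟨ xyx⁻¹≈y x y ⟩
      y                ∎

  -- with b = 1 - a:  recipS a = Σ_m b^m, so  recipS a · a = Σ_m b^m - Σ_m b^{m+1} = 1
  recipS-inverse : ∀ a → a 0 ≈ 1# → mulS (recipS a) a ≈S oneS
  recipS-inverse a a0≈1 = ≈S-trans (mulS-congʳ r a≈1-b)
                            (≈S-trans (mulS-−ʳ r oneS b)
                              (λ n → trans (+-cong (mulS-oneʳ r n) (-‿cong (r·b n))) (telescope n)))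
    where
    b : Series
    b = oneS -S a
    b0≈0 : b 0 ≈ 0#
    b0≈0 = trans (+-congˡ (-‿cong a0≈1)) (-‿inverseʳ 1#)
    open Powers b b0≈0
    open Composition b b0≈0

    r : Series
    r = recipS a

    a≈1-b : a ≈S (oneS -S b)
    a≈1-b n = sym (x-[x-y]≈y (oneS n) (a n))

    r·b : mulS r b ≈S Σ∞ (λ m → powS b (suc m))
    r·b = ≈S-trans (compS-mulS (λ _ → 1#) b) (Σ∞-cong (λ m k → trans (*-identityˡ _) (mulS-comm (powS b m) b k)))

    telescope : ∀ n → r n - Σ∞ (λ m → powS b (suc m)) n ≈ oneS n
    telescope zero = trans (+-cong (*-identityˡ _) (-‿cong (powS-order 1 0 (s≤s z≤n))))
                           (trans (+-congˡ ε⁻¹≈ε) (+-identityʳ 1#))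
    telescope (suc n) = begin
        r (suc n) - (Y + powS b (suc (suc n)) (suc n))
      ≈⟨ +-cong (Σ-peel n _) (-‿cong (trans (+-congˡ (powS-order (suc (suc n)) (suc n) ℕₚ.≤-refl)) (+-identityʳ Y))) ⟩
        (1# * oneS (suc n) + sumTo n (λ m → 1# * powS b (suc m) (suc n))) - Y
      ≈⟨ +-congʳ (+-cong (zeroʳ _) (Σ-cong′ n (λ m → *-identityˡ _))) ⟩
        (0# + Y) - Y
      ≈⟨ +-congʳ (+-identityˡ Y) ⟩
        Y - Y
      ≈⟨ -‿inverseʳ Y ⟩
        0# ∎
      where
      Y : Carrier
      Y = sumTo n (λ m → powS b (suc m) (suc n))

  -- The key relation  f ∘ h = x h'  for g = 𝔗⁻¹ f and h = g^{inv}

  T-inverse : ∀ f g → T g ≈S f → g 1 ≈ 1# → mulS f (derivS g) ≈S g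
  T-inverse f g Tg≈f g1≈1 =
    ≈S-trans (mulS-congˡ (derivS g) (≈S-sym Tg≈f))
      (≈S-trans (mulS-assoc g (recipS (derivS g)) (derivS g))
        (≈S-trans (mulS-congʳ g (recipS-inverse (derivS g) g′0≈1)) (mulS-oneʳ g)))
    where
    g′0≈1 : derivS g 0 ≈ 1#
    g′0≈1 = trans (*-cong nat-one g1≈1) (*-identityˡ 1#)

  -- composing f g' = g with h = g^{inv}:  (f∘h)(g'∘h) = x  and  (g'∘h) h' = (g∘h)' = 1
  compose-with-inverse : ∀ f g h → T g ≈S f → g 1 ≈ 1# → h 0 ≈ 0# → compS g h ≈S xS →
                         compS f h ≈S mulS xS (derivS h)
  compose-with-inverse f g h Tg≈f g1≈1 h0≈0 g∘h≈x =
    ≈S-trans (≈S-sym (mulS-oneʳ (compS f h)))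
      (≈S-trans (mulS-congʳ (compS f h) (≈S-sym g′∘h·h′≈1))
        (≈S-trans (≈S-sym (mulS-assoc (compS f h) (compS (derivS g) h) (derivS h)))
          (mulS-congˡ (derivS h) f∘h·g′∘h≈x)))
    where
    open Composition h h0≈0
    open Derivation h h0≈0

    f∘h·g′∘h≈x : mulS (compS f h) (compS (derivS g) h) ≈S xS
    f∘h·g′∘h≈x = ≈S-trans (≈S-sym (compS-hom f (derivS g))) (≈S-trans (compS-congˡ (T-inverse f g Tg≈f g1≈1)) g∘h≈x)

    g′∘h·h′≈1 : mulS (compS (derivS g) h) (derivS h) ≈S oneS
    g′∘h·h′≈1 = ≈S-trans (≈S-sym (chain-rule g)) (≈S-trans (derivS-cong g∘h≈x) derivS-x)

  -- Consequence for the coefficients of powers of h: multiplying f∘h = x h' by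
  -- (i+1) h^i gives  Σ_m f_m h^{i+m} · (i+1) = x (h^{i+1})',  whose n-th
  -- coefficient is n [xⁿ] h^{i+1}.
  module PowerIdentity (f h : Series) (h0≈0 : h 0 ≈ 0#) (f∘h≈xh′ : compS f h ≈S mulS xS (derivS h)) where
    open Powers h h0≈0
    open Composition h h0≈0
    open Derivation h h0≈0

    Σ-f-powS : ∀ i n → sumTo n (λ m → f m * powS h (i +ℕ m) n) ≈ mulS xS (mulS (powS h i) (derivS h)) n
    Σ-f-powS i n = begin
        sumTo n (λ m → f m * powS h (i +ℕ m) n)
      ≈⟨ Σ-cong′ n (λ m → *-congˡ (trans (powS-+ i m n) (mulS-comm (powS h i) (powS h m) n))) ⟩
        sumTo n (λ m → f m * mulS (powS h m) (powS h i) n)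
      ≈⟨ compS-mulS f (powS h i) n ⟨
        mulS (compS f h) (powS h i) n
      ≈⟨ mulS-congˡ (powS h i) f∘h≈xh′ n ⟩
        mulS (mulS xS (derivS h)) (powS h i) n
      ≈⟨ mulS-assoc xS (derivS h) (powS h i) n ⟩
        mulS xS (mulS (derivS h) (powS h i)) n
      ≈⟨ mulS-congʳ xS (mulS-comm (derivS h) (powS h i)) n ⟩
        mulS xS (mulS (powS h i) (derivS h)) n ∎

    euler : ∀ i n → nat (suc i) * mulS xS (mulS (powS h i) (derivS h)) n ≈ nat n * powS h (suc i) n
    euler i zero    = trans (*-congˡ (mulS-x-zero (mulS (powS h i) (derivS h)))) (trans (zeroʳ _) (sym (zeroˡ _)))
    euler i (suc n) = begin
        nat (suc i) * mulS xS (mulS (powS h i) (derivS h)) (suc n)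
      ≈⟨ *-congˡ (mulS-x-suc (mulS (powS h i) (derivS h)) n) ⟩
        nat (suc i) * mulS (powS h i) (derivS h) n
      ≈⟨ derivS-powS i n ⟨
        nat (suc n) * powS h (suc i) (suc n) ∎

    power-identity : ∀ i n → nat (suc i) * sumTo (suc n) (λ m → f m * powS h (i +ℕ m) n) ≈ nat n * powS h (suc i) n
    power-identity i n = trans (*-congˡ (trans (Σ-extend n (suc n) _ (ℕₚ.n≤1+n n) lastVanishes) (Σ-f-powS i n)))
                               (euler i n)
      where
      lastVanishes : ∀ m → n < m → m ≤ suc n → f m * powS h (i +ℕ m) n ≈ 0#
      lastVanishes m n<m _ = trans (*-congˡ (powS-order (i +ℕ m) n (ℕₚ.<-≤-trans n<m (ℕₚ.m≤n+m m i)))) (zeroʳ _)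

  -- Polynomials in α (coefficient lists)

  coeff-+P : ∀ p q i → coeff (p +P q) i ≈ coeff p i + coeff q i
  coeff-+P []      q       i       = sym (+-identityˡ _)
  coeff-+P (a ∷ p) []      zero    = sym (+-identityʳ _)
  coeff-+P (a ∷ p) []      (suc i) = sym (+-identityʳ _)
  coeff-+P (a ∷ p) (b ∷ q) zero    = refl
  coeff-+P (a ∷ p) (b ∷ q) (suc i) = coeff-+P p q i

  coeff-scaleP : ∀ x p i → coeff (scaleP x p) i ≈ x * coeff p i
  coeff-scaleP x []      i       = sym (zeroʳ _)
  coeff-scaleP x (a ∷ p) zero    = refl
  coeff-scaleP x (a ∷ p) (suc i) = coeff-scaleP x p i

  +P-cong : ∀ p p′ q q′ → p ≈P p′ → q ≈P q′ → (p +P q) ≈P (p′ +P q′)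
  +P-cong p p′ q q′ p≈ q≈ i = trans (coeff-+P p q i) (trans (+-cong (p≈ i) (q≈ i)) (sym (coeff-+P p′ q′ i)))

  scaleP-cong : ∀ x p p′ → p ≈P p′ → scaleP x p ≈P scaleP x p′
  scaleP-cong x p p′ p≈ i = trans (coeff-scaleP x p i) (trans (*-congˡ (p≈ i)) (sym (coeff-scaleP x p′ i)))

  length-scaleP : ∀ x p → length (scaleP x p) ≡ length p
  length-scaleP x []      = Eq.refl
  length-scaleP x (a ∷ p) = Eq.cong suc (length-scaleP x p)

  length-+P : ∀ p q → length (p +P q) ≤ length p +ℕ length q
  length-+P []      q       = ℕₚ.≤-refl
  length-+P (a ∷ p) []      = ℕₚ.m≤m+n _ 0
  length-+P (a ∷ p) (b ∷ q) = s≤s (ℕₚ.≤-trans (length-+P p q) (ℕₚ.+-monoʳ-≤ (length p) (ℕₚ.n≤1+n _)))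

  coeff-beyond : ∀ p i → length p ≤ i → coeff p i ≡ 0#
  coeff-beyond []      i       _       = Eq.refl
  coeff-beyond (a ∷ p) (suc i) (s≤s l) = coeff-beyond p i l

  length-tab : ∀ L e → length (tab L e) ≡ L
  length-tab zero    e = Eq.refl
  length-tab (suc L) e = Eq.cong suc (length-tab L (λ k → e (suc k)))

  coeff-tab : ∀ L e i → i < L → coeff (tab L e) i ≡ e i
  coeff-tab (suc L) e zero    _       = Eq.refl
  coeff-tab (suc L) e (suc i) (s≤s l) = coeff-tab L (λ k → e (suc k)) i l

  DegreeBelow : ℕ → Poly → Set ℓ
  DegreeBelow d p = ∀ i → d ≤ i → coeff p i ≈ 0#

  length-degree : ∀ {d} p → length p ≤ d → DegreeBelow d p
  length-degree p len≤d i d≤i = reflexive (coeff-beyond p i (ℕₚ.≤-trans len≤d d≤i))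

  _-P_ : Poly → Poly → Poly
  q -P p = q +P scaleP (- 1#) p

  coeff-−P : ∀ q p i → coeff (q -P p) i ≈ coeff q i - coeff p i
  coeff-−P q p i = trans (coeff-+P q _ i) (+-congˡ (trans (coeff-scaleP _ p i) (-1*x≈-x _)))

  +P-difference : ∀ p q → q ≈P (p +P (q -P p))
  +P-difference p q i = sym (begin
      coeff (p +P (q -P p)) i           ≈⟨ trans (coeff-+P p _ i) (+-congˡ (coeff-−P q p i)) ⟩
      coeff p i + (coeff q i - coeff p i) ≈⟨ solve 3 (λ a b c → a :+ (b :+ c) := b :+ (a :+ c)) refl _ _ _ ⟩
      coeff q i + (coeff p i - coeff p i) ≈⟨ trans (+-congˡ (-‿inverseʳ _)) (+-identityʳ _) ⟩
      coeff q i                         ∎)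

  monic-difference : ∀ n p q → MonicOfDegree n p → MonicOfDegree n q → DegreeBelow n (q -P p)
  monic-difference n p q (len-p , p-lead) (len-q , q-lead) i n≤i = trans (coeff-−P q p i) (vanish i n≤i)
    where
    vanish : ∀ i → n ≤ i → coeff q i - coeff p i ≈ 0#
    vanish i n≤i with i ≟ℕ n
    ... | yes Eq.refl = trans (+-cong q-lead (-‿cong p-lead)) (-‿inverseʳ 1#)
    ... | no  i≢n     = trans (+-cong (length-degree q (ℕₚ.≤-reflexive len-q) i n<i)
                                      (-‿cong (length-degree p (ℕₚ.≤-reflexive len-p) i n<i)))
                              (-‿inverseʳ 0#)
      where
      n<i : suc n ≤ i
      n<i = ℕₚ.≤∧≢⇒< n≤i (λ e → i≢n (Eq.sym e))

  -- rising i k = (i+1)(i+2)⋯(i+k), so that D^k α^{i+k} = rising i k · α^i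
  rising : ℕ → ℕ → Carrier
  rising i zero    = 1#
  rising i (suc k) = nat (suc i) * rising (suc i) k

  coeff-Dhelp : ∀ m p i → coeff (Dhelp m p) i ≈ nat (m +ℕ i) * coeff p i
  coeff-Dhelp m []      i       = sym (zeroʳ _)
  coeff-Dhelp m (b ∷ p) zero    = *-congʳ (reflexive (Eq.cong nat (Eq.sym (ℕₚ.+-identityʳ m))))
  coeff-Dhelp m (b ∷ p) (suc i) = trans (coeff-Dhelp (suc m) p i) (*-congʳ (reflexive (Eq.cong nat (Eq.sym (ℕₚ.+-suc m i)))))

  coeff-D : ∀ p i → coeff (D p) i ≈ nat (suc i) * coeff p (suc i)
  coeff-D []      i = sym (zeroʳ _)
  coeff-D (a ∷ p) i = coeff-Dhelp 1 p i

  coeff-Dpow : ∀ k p i → coeff (Dpow k p) i ≈ rising i k * coeff p (i +ℕ k)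
  coeff-Dpow zero    p i = trans (reflexive (Eq.cong (coeff p) (Eq.sym (ℕₚ.+-identityʳ i)))) (sym (*-identityˡ _))
  coeff-Dpow (suc k) p i = begin
      coeff (D (Dpow k p)) i
    ≈⟨ coeff-D (Dpow k p) i ⟩
      nat (suc i) * coeff (Dpow k p) (suc i)
    ≈⟨ *-congˡ (coeff-Dpow k p (suc i)) ⟩
      nat (suc i) * (rising (suc i) k * coeff p (suc i +ℕ k))
    ≈⟨ *-assoc _ _ _ ⟨
      rising i (suc k) * coeff p (suc i +ℕ k)
    ≈⟨ *-congˡ (reflexive (Eq.cong (coeff p) (Eq.sym (ℕₚ.+-suc i k)))) ⟩
      rising i (suc k) * coeff p (i +ℕ suc k) ∎

  -- Factorials in R

  fallingNat : ℕ → ℕ → Carrier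
  fallingNat n zero    = 1#
  fallingNat n (suc m) = (nat n - nat m) * fallingNat n m

  fallingNat-fact : ∀ m a → fallingNat (m +ℕ a) m * fact a ≈ fact (m +ℕ a)
  fallingNat-fact zero    a = *-identityˡ _
  fallingNat-fact (suc m) a = begin
      (nat (suc m +ℕ a) - nat m) * fallingNat (suc m +ℕ a) m * fact a
    ≈⟨ *-congʳ (*-cong top-factor (reflexive (Eq.cong (λ t → fallingNat t m) m+1+a≡))) ⟩
      nat (suc a) * fallingNat (m +ℕ suc a) m * fact a
    ≈⟨ solve 3 (λ x y z → x :* y :* z := y :* (x :* z)) refl _ _ _ ⟩
      fallingNat (m +ℕ suc a) m * fact (suc a)
    ≈⟨ fallingNat-fact m (suc a) ⟩
      fact (m +ℕ suc a)
    ≈⟨ reflexive (Eq.cong fact m+1+a≡) ⟨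
      fact (suc m +ℕ a) ∎
    where
    m+1+a≡ : suc m +ℕ a ≡ m +ℕ suc a
    m+1+a≡ = Eq.sym (ℕₚ.+-suc m a)

    top-factor : nat (suc m +ℕ a) - nat m ≈ nat (suc a)
    top-factor = trans (+-congʳ (trans (reflexive (Eq.cong nat m+1+a≡)) (nat-+ m (suc a)))) (xyx⁻¹≈y _ _)

  fallingNat-self : ∀ n → fallingNat n n ≈ fact n
  fallingNat-self n = begin
      fallingNat n n                ≈⟨ *-identityʳ _ ⟨
      fallingNat n n * fact 0       ≈⟨ reflexive (Eq.cong (λ t → fallingNat t n * 1#) (Eq.sym (ℕₚ.+-identityʳ n))) ⟩
      fallingNat (n +ℕ 0) n * fact 0 ≈⟨ fallingNat-fact n 0 ⟩
      fact (n +ℕ 0)                 ≈⟨ reflexive (Eq.cong fact (ℕₚ.+-identityʳ n)) ⟩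
      fact n                        ∎

  module Inverses (invertible : InvertsPositiveIntegers) where

    fact-invFact : ∀ n → fact n * invFact n ≈ 1#
    fact-invFact zero    = *-identityˡ 1#
    fact-invFact (suc n) = begin
        nat (suc n) * fact n * (inv n * invFact n)
      ≈⟨ solve 4 (λ a b x y → a :* b :* (x :* y) := (a :* x) :* (b :* y)) refl _ _ _ _ ⟩
        (nat (suc n) * inv n) * (fact n * invFact n)
      ≈⟨ *-cong (invertible n) (fact-invFact n) ⟩
        1# * 1#
      ≈⟨ *-identityˡ 1# ⟩
        1# ∎

    nat-invFact : ∀ i → nat (suc i) * invFact (suc i) ≈ invFact i
    nat-invFact i = trans (sym (*-assoc _ _ _)) (trans (*-congʳ (invertible i)) (*-identityˡ _))

    rising-invFact : ∀ i m → rising i m * invFact (i +ℕ m) ≈ invFact i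
    rising-invFact i zero    = trans (*-identityˡ _) (reflexive (Eq.cong invFact (ℕₚ.+-identityʳ i)))
    rising-invFact i (suc m) = begin
        nat (suc i) * rising (suc i) m * invFact (i +ℕ suc m)
      ≈⟨ *-congˡ (reflexive (Eq.cong invFact (ℕₚ.+-suc i m))) ⟩
        nat (suc i) * rising (suc i) m * invFact (suc i +ℕ m)
      ≈⟨ *-assoc _ _ _ ⟩
        nat (suc i) * (rising (suc i) m * invFact (suc i +ℕ m))
      ≈⟨ *-congˡ (rising-invFact (suc i) m) ⟩
        nat (suc i) * invFact (suc i)
      ≈⟨ nat-invFact i ⟩
        invFact i ∎

    divide-by-fact : ∀ n P p → p ≈P scaleP (fact n) P → P ≈P scaleP (invFact n) p
    divide-by-fact n P p p≈n!P i = sym (begin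
        coeff (scaleP (invFact n) p) i     ≈⟨ trans (coeff-scaleP _ p i) (*-congˡ (trans (p≈n!P i) (coeff-scaleP _ P i))) ⟩
        invFact n * (fact n * coeff P i)   ≈⟨ *-assoc _ _ _ ⟨
        (invFact n * fact n) * coeff P i   ≈⟨ *-congʳ (trans (*-comm _ _) (fact-invFact n)) ⟩
        1# * coeff P i                     ≈⟨ *-identityˡ _ ⟩
        coeff P i                          ∎)

  -- The operator X = α f(D) and its falling factorials (X)_m

  module Operator (f : Series) where

    X : Poly → Poly
    X = αfD f

    -- contribution of f_m D^m to the coefficient of α^i in f(D) p
    term : Poly → ℕ → ℕ → Carrier
    term p i m = f m * (rising i m * coeff p (i +ℕ m))

    coeff-fDsum : ∀ K p i → coeff (fDsum f K p) i ≈ sumTo K (term p i)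
    coeff-fDsum zero    p i = trans (coeff-scaleP (f 0) p i) (*-congˡ (coeff-Dpow 0 p i))
    coeff-fDsum (suc K) p i =
      trans (coeff-+P (fDsum f K p) (scaleP (f (suc K)) (Dpow (suc K) p)) i)
            (+-cong (coeff-fDsum K p i)
                    (trans (coeff-scaleP (f (suc K)) (Dpow (suc K) p) i) (*-congˡ (coeff-Dpow (suc K) p i))))

    coeff-fD : ∀ p i M → length p ≤ M → coeff (fD f p) i ≈ sumTo M (term p i)
    coeff-fD p i M len≤M = trans (coeff-fDsum (length p) p i)
      (sym (Σ-extend (length p) M _ len≤M (λ m len<m _ →
        trans (*-congˡ (trans (*-congˡ (reflexive (coeff-beyond p (i +ℕ m)
                                          (ℕₚ.≤-trans (ℕₚ.<⇒≤ len<m) (ℕₚ.m≤n+m m i))))) (zeroʳ _)))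
              (zeroʳ _))))

    X-cong : ∀ p q → p ≈P q → X p ≈P X q
    X-cong p q p≈q zero    = refl
    X-cong p q p≈q (suc i) =
      trans (coeff-fD p i M (ℕₚ.m≤m+n _ _))
        (trans (Σ-cong′ M (λ m → *-congˡ (*-congˡ (p≈q _)))) (sym (coeff-fD q i M (ℕₚ.m≤n+m _ _))))
      where
      M : ℕ
      M = length p +ℕ length q

    X-+ : ∀ p q → X (p +P q) ≈P (X p +P X q)
    X-+ p q zero    = sym (+-identityʳ 0#)
    X-+ p q (suc i) = begin
        coeff (fD f (p +P q)) i
      ≈⟨ coeff-fD (p +P q) i M (length-+P p q) ⟩
        sumTo M (term (p +P q) i)
      ≈⟨ Σ-cong′ M (λ m → trans (*-congˡ (trans (*-congˡ (coeff-+P p q _)) (distribˡ _ _ _))) (distribˡ _ _ _)) ⟩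
        sumTo M (λ m → term p i m + term q i m)
      ≈⟨ Σ-+ M _ _ ⟩
        sumTo M (term p i) + sumTo M (term q i)
      ≈⟨ +-cong (coeff-fD p i M (ℕₚ.m≤m+n _ _)) (coeff-fD q i M (ℕₚ.m≤n+m _ _)) ⟨
        coeff (fD f p) i + coeff (fD f q) i
      ≈⟨ coeff-+P (X p) (X q) (suc i) ⟨
        coeff (X p +P X q) (suc i) ∎
      where
      M : ℕ
      M = length p +ℕ length q

    X-scale : ∀ x p → X (scaleP x p) ≈P scaleP x (X p)
    X-scale x p zero    = sym (zeroʳ x)
    X-scale x p (suc i) = begin
        coeff (fD f (scaleP x p)) i
      ≈⟨ coeff-fD (scaleP x p) i (length p) (ℕₚ.≤-reflexive (length-scaleP x p)) ⟩
        sumTo (length p) (term (scaleP x p) i)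
      ≈⟨ Σ-cong′ (length p) (λ m → trans (*-congˡ (*-congˡ (coeff-scaleP x p _)))
           (solve 4 (λ a b d e → a :* (b :* (d :* e)) := d :* (a :* (b :* e))) refl _ _ _ _)) ⟩
        sumTo (length p) (λ m → x * term p i m)
      ≈⟨ Σ-*ˡ (length p) x _ ⟨
        x * sumTo (length p) (term p i)
      ≈⟨ *-congˡ (coeff-fD p i (length p) ℕₚ.≤-refl) ⟨
        x * coeff (fD f p) i
      ≈⟨ coeff-scaleP x (X p) (suc i) ⟨
        coeff (scaleP x (X p)) (suc i) ∎

    shifted : ℕ → Poly → Poly
    shifted m p = X p +P scaleP (- nat m) p

    falling : ℕ → Poly → Poly
    falling = fallingαfD f

    coeff-shifted : ∀ m p i → coeff (shifted m p) i ≈ coeff (X p) i + (- nat m) * coeff p i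
    coeff-shifted m p i = trans (coeff-+P (X p) (scaleP (- nat m) p) i) (+-congˡ (coeff-scaleP (- nat m) p i))

    shifted-cong : ∀ m p q → p ≈P q → shifted m p ≈P shifted m q
    shifted-cong m p q p≈q = +P-cong (X p) (X q) (scaleP (- nat m) p) (scaleP (- nat m) q)
                               (X-cong p q p≈q) (scaleP-cong (- nat m) p q p≈q)

    shifted-+ : ∀ m p q → shifted m (p +P q) ≈P (shifted m p +P shifted m q)
    shifted-+ m p q i = begin
        coeff (shifted m (p +P q)) i
      ≈⟨ coeff-shifted m (p +P q) i ⟩
        coeff (X (p +P q)) i + (- nat m) * coeff (p +P q) i
      ≈⟨ +-cong (trans (X-+ p q i) (coeff-+P (X p) (X q) i)) (*-congˡ (coeff-+P p q i)) ⟩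
        (coeff (X p) i + coeff (X q) i) + (- nat m) * (coeff p i + coeff q i)
      ≈⟨ solve 5 (λ a b y u v → (a :+ b) :+ y :* (u :+ v) := (a :+ y :* u) :+ (b :+ y :* v)) refl _ _ _ _ _ ⟩
        (coeff (X p) i + (- nat m) * coeff p i) + (coeff (X q) i + (- nat m) * coeff q i)
      ≈⟨ +-cong (coeff-shifted m p i) (coeff-shifted m q i) ⟨
        coeff (shifted m p) i + coeff (shifted m q) i
      ≈⟨ coeff-+P (shifted m p) (shifted m q) i ⟨
        coeff (shifted m p +P shifted m q) i ∎

    shifted-scale : ∀ m x p → shifted m (scaleP x p) ≈P scaleP x (shifted m p)
    shifted-scale m x p i = begin
        coeff (shifted m (scaleP x p)) i
      ≈⟨ coeff-shifted m (scaleP x p) i ⟩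
        coeff (X (scaleP x p)) i + (- nat m) * coeff (scaleP x p) i
      ≈⟨ +-cong (trans (X-scale x p i) (coeff-scaleP x (X p) i)) (*-congˡ (coeff-scaleP x p i)) ⟩
        x * coeff (X p) i + (- nat m) * (x * coeff p i)
      ≈⟨ solve 4 (λ x a y u → x :* a :+ y :* (x :* u) := x :* (a :+ y :* u)) refl _ _ _ _ ⟩
        x * (coeff (X p) i + (- nat m) * coeff p i)
      ≈⟨ *-congˡ (coeff-shifted m p i) ⟨
        x * coeff (shifted m p) i
      ≈⟨ coeff-scaleP x (shifted m p) i ⟨
        coeff (scaleP x (shifted m p)) i ∎

    falling-cong : ∀ m p q → p ≈P q → falling m p ≈P falling m q
    falling-cong zero    p q p≈q = p≈q
    falling-cong (suc m) p q p≈q = falling-cong m _ _ (shifted-cong m p q p≈q)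

    falling-+ : ∀ m p q → falling m (p +P q) ≈P (falling m p +P falling m q)
    falling-+ zero    p q i = refl
    falling-+ (suc m) p q i = trans (falling-cong m _ _ (shifted-+ m p q) i) (falling-+ m (shifted m p) (shifted m q) i)

    falling-scale : ∀ m x p → falling m (scaleP x p) ≈P scaleP x (falling m p)
    falling-scale zero    x p i = refl
    falling-scale (suc m) x p i = trans (falling-cong m _ _ (shifted-scale m x p) i) (falling-scale m x (shifted m p) i)

    -- When f_0 = 0 and f_1 = 1, X is triangular with diagonal 0, 1, 2, …:
    -- X α^d = d α^d + lower terms.
    module Triangular (f0≈0 : f 0 ≈ 0#) (f1≈1 : f 1 ≈ 1#) where

      term-zero : ∀ p i → term p i 0 ≈ 0#
      term-zero p i = trans (*-congʳ f0≈0) (zeroˡ _)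

      term-beyond : ∀ {d} p → DegreeBelow d p → ∀ i k → d ≤ i +ℕ suc k → term p i (suc k) ≈ 0#
      term-beyond p deg<d i k d≤ = trans (*-congˡ (trans (*-congˡ (deg<d _ d≤)) (zeroʳ _))) (zeroʳ _)

      X-degree : ∀ {d} p → DegreeBelow d p → DegreeBelow d (X p)
      X-degree p deg<d zero    _  = refl
      X-degree p deg<d (suc i) d≤ = trans (coeff-fD p i (length p) ℕₚ.≤-refl) (Σ-zero (length p) vanish)
        where
        vanish : ∀ m → m ≤ length p → term p i m ≈ 0#
        vanish zero    _ = term-zero p i
        vanish (suc k) _ = term-beyond p deg<d i k
          (ℕₚ.≤-trans d≤ (ℕₚ.≤-trans (ℕₚ.≤-reflexive (ℕₚ.+-comm 1 i)) (ℕₚ.+-monoʳ-≤ i (s≤s z≤n))))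

      X-diagonal : ∀ d p → DegreeBelow (suc d) p → coeff (X p) d ≈ nat d * coeff p d
      X-diagonal zero    p _     = sym (zeroˡ _)
      X-diagonal (suc i) p deg<d = begin
          coeff (fD f p) i
        ≈⟨ coeff-fD p i (suc (length p)) (ℕₚ.n≤1+n _) ⟩
          sumTo (suc (length p)) (term p i)
        ≈⟨ Σ-single (suc (length p)) 1 _ (s≤s z≤n) offDiagonal ⟩
          f 1 * ((nat (suc i) * 1#) * coeff p (i +ℕ 1))
        ≈⟨ trans (*-cong f1≈1 (*-cong (*-identityʳ _) (reflexive (Eq.cong (coeff p) (ℕₚ.+-comm i 1)))))
                 (*-identityˡ _) ⟩
          nat (suc i) * coeff p (suc i) ∎
        where
        offDiagonal : ∀ m → m ≤ suc (length p) → ¬ m ≡ 1 → term p i m ≈ 0#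
        offDiagonal zero          _ _   = term-zero p i
        offDiagonal (suc zero)    _ m≢1 = ⊥-elim (m≢1 Eq.refl)
        offDiagonal (suc (suc k)) _ _   = term-beyond p deg<d i (suc k)
          (ℕₚ.≤-trans (ℕₚ.≤-reflexive (ℕₚ.+-comm 2 i)) (ℕₚ.+-monoʳ-≤ i (s≤s (s≤s z≤n))))

      -- X - m kills the α^m coefficient, so it lowers the degree of p when deg p ≤ m
      shifted-lowers-degree : ∀ m p → DegreeBelow (suc m) p → DegreeBelow m (shifted m p)
      shifted-lowers-degree m p deg≤m i m≤i with i ≟ℕ m
      ... | yes Eq.refl = begin
          coeff (shifted m p) m
        ≈⟨ coeff-shifted m p m ⟩
          coeff (X p) m + (- nat m) * coeff p m
        ≈⟨ +-cong (X-diagonal m p deg≤m) (sym (-‿distribˡ-* _ _)) ⟩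
          nat m * coeff p m - nat m * coeff p m
        ≈⟨ -‿inverseʳ _ ⟩
          0# ∎
      ... | no  i≢m = trans (coeff-shifted m p i)
                       (trans (+-cong (X-degree p deg≤m i m<i) (trans (*-congˡ (deg≤m i m<i)) (zeroʳ _)))
                              (+-identityˡ 0#))
        where
        m<i : suc m ≤ i
        m<i = ℕₚ.≤∧≢⇒< m≤i (λ e → i≢m (Eq.sym e))

      falling-annihilates : ∀ m p → DegreeBelow m p → ∀ i → coeff (falling m p) i ≈ 0#
      falling-annihilates zero    p deg<0 i = deg<0 i z≤n
      falling-annihilates (suc m) p deg≤m   = falling-annihilates m (shifted m p) (shifted-lowers-degree m p deg≤m)

    module Eigenvector (n : ℕ) (P : Poly) (XP≈nP : X P ≈P scaleP (nat n) P) where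

      shifted-eigen : ∀ m → shifted m P ≈P scaleP (nat n - nat m) P
      shifted-eigen m i = trans (coeff-shifted m P i)
        (trans (+-congʳ (trans (XP≈nP i) (coeff-scaleP (nat n) P i)))
               (trans (sym (distribʳ _ _ _)) (sym (coeff-scaleP _ P i))))

      falling-eigen : ∀ m → falling m P ≈P scaleP (fallingNat n m) P
      falling-eigen zero    i = sym (trans (coeff-scaleP 1# P i) (*-identityˡ _))
      falling-eigen (suc m) i = begin
          coeff (falling m (shifted m P)) i
        ≈⟨ falling-cong m _ _ (shifted-eigen m) i ⟩
          coeff (falling m (scaleP (nat n - nat m) P)) i
        ≈⟨ trans (falling-scale m _ P i) (coeff-scaleP _ (falling m P) i) ⟩
          (nat n - nat m) * coeff (falling m P) i
        ≈⟨ *-congˡ (trans (falling-eigen m i) (coeff-scaleP _ P i)) ⟩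
          (nat n - nat m) * (fallingNat n m * coeff P i)
        ≈⟨ *-assoc _ _ _ ⟨
          fallingNat n (suc m) * coeff P i
        ≈⟨ coeff-scaleP _ P i ⟨
          coeff (scaleP (fallingNat n (suc m)) P) i ∎

      -- If moreover P is monic of degree n, then (X)_n q = n! P for every monic q of
      -- degree n: q - P has degree < n and is annihilated by (X)_n.
      falling-monic : f 0 ≈ 0# → f 1 ≈ 1# → MonicOfDegree n P →
                      ∀ q → MonicOfDegree n q → falling n q ≈P scaleP (fact n) P
      falling-monic f0≈0 f1≈1 P-monic q q-monic i = begin
          coeff (falling n q) i
        ≈⟨ falling-cong n q (P +P r) (+P-difference P q) i ⟩
          coeff (falling n (P +P r)) i
        ≈⟨ trans (falling-+ n P r i) (coeff-+P (falling n P) (falling n r) i) ⟩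
          coeff (falling n P) i + coeff (falling n r) i
        ≈⟨ +-cong (falling-eigen n i) (falling-annihilates n r (monic-difference n P q P-monic q-monic) i) ⟩
          coeff (scaleP (fallingNat n n) P) i + 0#
        ≈⟨ +-identityʳ _ ⟩
          coeff (scaleP (fallingNat n n) P) i
        ≈⟨ trans (coeff-scaleP _ P i) (trans (*-congʳ (fallingNat-self n)) (sym (coeff-scaleP _ P i))) ⟩
          coeff (scaleP (fact n) P) i ∎
        where
        open Triangular f0≈0 f1≈1
        r : Poly
        r = q -P P

  -- The polynomials p_n^h = n! [xⁿ] exp(α h(x))

  module ExponentialPolynomials (h : Series) (h0≈0 : h 0 ≈ 0#) where
    open Powers h h0≈0

    length-pPoly : ∀ n → length (pPoly h n) ≡ suc n
    length-pPoly n = length-tab (suc n) (λ k → fact n * expCoeff h n k)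

    -- [α^i] p_n^h = n! [xⁿ] h^i / i!, also for i > n since then [xⁿ] h^i = 0
    coeff-pPoly : ∀ n i → coeff (pPoly h n) i ≈ fact n * (invFact i * powS h i n)
    coeff-pPoly n i with i <? suc n
    ... | yes i≤n = reflexive (coeff-tab (suc n) (λ k → fact n * expCoeff h n k) i i≤n)
    ... | no  i≰n = trans (length-degree (pPoly h n) (ℕₚ.≤-reflexive (length-pPoly n)) i (ℕₚ.≮⇒≥ i≰n))
                          (sym (trans (*-congˡ (trans (*-congˡ (powS-order i n (ℕₚ.≮⇒≥ i≰n))) (zeroʳ _))) (zeroʳ _)))

    pPoly-monic : InvertsPositiveIntegers → h 1 ≈ 1# → ∀ n → MonicOfDegree n (pPoly h n)
    pPoly-monic invertible h1≈1 n = length-pPoly n , leading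
      where
      open Inverses invertible
      leading : coeff (pPoly h n) n ≈ 1#
      leading = trans (coeff-pPoly n n)
                      (trans (*-congˡ (trans (*-congˡ (powS-leading h1≈1 n)) (*-identityʳ _))) (fact-invFact n))

    -- the constant term of p_n^h vanishes for n > 0, as h^0 = 1
    constant-term : ∀ n → nat n * coeff (pPoly h n) 0 ≈ 0#
    constant-term zero    = zeroˡ _
    constant-term (suc n) = trans (*-congˡ (trans (coeff-pPoly (suc n) 0) (trans (*-congˡ (zeroʳ _)) (zeroʳ _))))
                                  (zeroʳ _)

    pPoly-eigen : InvertsPositiveIntegers → ∀ f → compS f h ≈S mulS xS (derivS h) →
                  ∀ n → αfD f (pPoly h n) ≈P scaleP (nat n) (pPoly h n)
    pPoly-eigen invertible f f∘h≈xh′ n zero    = sym (trans (coeff-scaleP (nat n) P 0) (constant-term n))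
      where
      P : Poly
      P = pPoly h n
    pPoly-eigen invertible f f∘h≈xh′ n (suc i) = begin
        coeff (fD f P) i
      ≈⟨ coeff-fD P i (suc n) (ℕₚ.≤-reflexive (length-pPoly n)) ⟩
        sumTo (suc n) (term P i)
      ≈⟨ Σ-cong′ (suc n) (λ m → trans (*-congˡ (*-congˡ (coeff-pPoly n (i +ℕ m))))
           (trans (solve 5 (λ a b u v w → a :* (b :* (u :* (v :* w))) := (u :* (b :* v)) :* (a :* w)) refl _ _ _ _ _)
                  (*-congʳ (*-congˡ (rising-invFact i m))))) ⟩
        sumTo (suc n) (λ m → (fact n * invFact i) * (f m * powS h (i +ℕ m) n))
      ≈⟨ Σ-*ˡ (suc n) _ _ ⟨
        (fact n * invFact i) * Σf
      ≈⟨ *-congʳ (*-congˡ (nat-invFact i)) ⟨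
        (fact n * (nat (suc i) * invFact (suc i))) * Σf
      ≈⟨ solve 4 (λ a b u s → (a :* (b :* u)) :* s := (a :* u) :* (b :* s)) refl _ _ _ _ ⟩
        (fact n * invFact (suc i)) * (nat (suc i) * Σf)
      ≈⟨ *-congˡ (power-identity i n) ⟩
        (fact n * invFact (suc i)) * (nat n * powS h (suc i) n)
      ≈⟨ solve 4 (λ a b u s → (a :* b) :* (u :* s) := u :* (a :* (b :* s))) refl _ _ _ _ ⟩
        nat n * (fact n * (invFact (suc i) * powS h (suc i) n))
      ≈⟨ trans (coeff-scaleP (nat n) P (suc i)) (*-congˡ (coeff-pPoly n (suc i))) ⟨
        coeff (scaleP (nat n) P) (suc i) ∎
      where
      open Inverses invertible
      open Operator f using (term; coeff-fD)
      open PowerIdentity f h h0≈0 f∘h≈xh′ using (power-identity)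
      P : Poly
      P = pPoly h n
      Σf : Carrier
      Σf = sumTo (suc n) (λ m → f m * powS h (i +ℕ m) n)

proposition3p1 : ∀ {c ℓ : Level} (R : CommutativeRing c ℓ)
    (inv : ℕ → CommutativeRing.Carrier R) →
    let open CommutativeRing R using (_≈_)
        open PS R inv
    in InvertsPositiveIntegers →
       (f : Series) → InX+X² f →
       (g : Series) → InX+X² g → T g ≈S f →
       (h : Series) → InX+X² h → compS g h ≈S xS →
       (k : Series) → InX+X² k → compS f k ≈S xS →
       (n : ℕ) →
       ((q : Poly) → MonicOfDegree n q →
          pPoly h n ≈P scaleP (invFact n) (fallingαfD f n q))
       × (pPoly h n ≈P scaleP (invFact n) (fallingαfD f n (pPoly k n)))
proposition3p1 R inv invertible f (f0≈0 , f1≈1) g (_ , g1≈1) 𝔗g≈f h (h0≈0 , h1≈1) g∘h≈x k (k0≈0 , k1≈1) _ n =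
  recover , recover (pPoly k n) (ExponentialPolynomials.pPoly-monic k k0≈0 invertible k1≈1 n)
  where
  open PS R inv
  open Development R inv
  open Inverses invertible using (divide-by-fact)
  open ExponentialPolynomials h h0≈0 using (pPoly-monic; pPoly-eigen)

  -- p_n^h is a monic eigenvector of α f(D) with eigenvalue n, because f ∘ h = x h'
  open Operator f using (module Eigenvector)
  open Eigenvector n (pPoly h n)
         (pPoly-eigen invertible f (compose-with-inverse f g h 𝔗g≈f g1≈1 h0≈0 g∘h≈x) n)
    using (falling-monic)

  recover : (q : Poly) → MonicOfDegree n q → pPoly h n ≈P scaleP (invFact n) (fallingαfD f n q)
  recover q q-monic = divide-by-fact n (pPoly h n) (fallingαfD f n q)
                        (falling-monic f0≈0 f1≈1 (pPoly-monic invertible h1≈1 n) q q-monic)
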